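{- Let $n\ge1$. Every cycle of odd length in the Hamming graph $H(n,4)$ contains three edges of the same direction having three pairwise different colors.
   Context: The Hamming graph $H(n,4)$ has vertex set $\{0,1,2,3\}^n$, two words being adjacent iff they differ in exactly one coordinate; the index of that coordinate is the direction of the edge. Each edge is colored by the pair of values $\{a,b\}$ taken by its two endpoints in the differing coordinate: color $1$ if $\{a,b\}$ is $\{0,1\}$ or $\{2,3\}$; color $2$ if $\{a,b\}$ is $\{0,2\}$ or $\{1,3\}$; color $3$ if $\{a,b\}$ is $\{0,3\}$ or $\{1,2\}$. -}

module Defs where

open import Data.Nat using (ℕ; suc; _≥_)
open import Data.Fin using (Fin; zero; suc; toℕ; fromℕ<)
open import Data.Nat.DivMod using (_%_; m%n<n)
open import Data.Product using (Σ; ∃; _×_; _,_)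
open import Relation.Binary.PropositionalEquality using (_≡_; _≢_)
open import Function.Definitions using (Injective)

Word : ℕ → Set
Word n = Fin n → Fin 4

AdjacentIn : ∀ {n} → Word n → Word n → Fin n → Set
AdjacentIn u v d = (u d ≢ v d) × (∀ j → j ≢ d → u j ≡ v j)

Adjacent : ∀ {n} → Word n → Word n → Set
Adjacent u v = ∃ λ d → AdjacentIn u v d

-- Colour of the pair {a,b} of distinct values (1,2,3); value on a ≡ b is
-- irrelevant (never used for edges).
colour : Fin 4 → Fin 4 → Fin 3
colour a b = colourℕ (toℕ a) (toℕ b)
  where
  colourℕ : ℕ → ℕ → Fin 3
  -- {0,1},{2,3} ↦ colour 1 (zero); {0,2},{1,3} ↦ colour 2; {0,3},{1,2} ↦ colour 3
  colourℕ 0 1 = zero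
  colourℕ 1 0 = zero
  colourℕ 2 3 = zero
  colourℕ 3 2 = zero
  colourℕ 0 2 = suc zero
  colourℕ 2 0 = suc zero
  colourℕ 1 3 = suc zero
  colourℕ 3 1 = suc zero
  colourℕ _ _ = suc (suc zero)

next : ∀ {m} → Fin (suc m) → Fin (suc m)
next {m} i = fromℕ< (m%n<n (suc (toℕ i)) (suc m))

-- A cycle of length L = suc m in H(n,4): L pairwise distinct vertices
-- v 0, …, v (L-1) with v i adjacent to v (i+1 mod L); edge i joins v i and
-- v (i+1 mod L).  (Length at least 3, as for any cycle in a simple graph.)
record Cycle (n m : ℕ) : Set where
  field
    len≥3    : suc m ≥ 3
    vert     : Fin (suc m) → Word n
    distinct : Injective _≡_ _≡_ vert
    adjacent : ∀ i → Adjacent (vert i) (vert (next i))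

EdgeDir : ∀ {n m} → Cycle n m → Fin (suc m) → Fin n → Set
EdgeDir C i d = AdjacentIn (Cycle.vert C i) (Cycle.vert C (next i)) d

edgeColour : ∀ {n m} → Cycle n m → Fin (suc m) → Fin n → Fin 3
edgeColour C i d = colour (Cycle.vert C i d) (Cycle.vert C (next i) d)

-- Identify {0,1,2,3} with 𝔽₂² via binary digits; the colour of an edge {a,b} is then the
-- nonzero vector a + b.  For a colour c let separator c be the nonzero linear form vanishing
-- on c: it takes different values at a and b exactly when {a,b} does not have colour c.
-- If no direction d of a cycle carried all three colours, pick for every d a colour c_d
-- missing in direction d; then w ↦ Σ_d separator c_d (w d) is a 2-colouring of the words
-- that changes along every edge of the cycle, so the cycle has even length.

module Submission where

open import Defs
open import Data.Nat using (ℕ; suc; _≥_)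
open import Data.Nat.DivMod using (_%_)
open import Data.Fin using (Fin)
open import Data.Product using (Σ; ∃; _×_; _,_)
open import Relation.Binary.PropositionalEquality using (_≡_; _≢_)

open import Data.Empty using (⊥-elim)
open import Data.Fin using (zero; toℕ; fromℕ<; punchIn) renaming (_≟_ to _≟ᶠ_)
open import Data.Fin.Patterns using (0F; 1F; 2F; 3F)
open import Data.Fin.Properties using (toℕ-injective; toℕ-fromℕ<; punchInᵢ≢i; any?; all?; ¬∀⟶∃¬)
open import Data.Nat using (_<_; parity)
open import Data.Nat.DivMod using (m<n⇒m%n≡m; n%n≡0)
open import Data.Nat.Properties using (n<1+n; <-trans)
open import Data.Parity using (Parity; 0ℙ; 1ℙ; _⁻¹; _+_) renaming (_≟_ to _≟ᵖ_)
open import Data.Parity.Properties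
  using (+-0-commutativeMonoid; +-assoc; +-cancelʳ-≡; ⁻¹-selfInverse; suc-homo-⁻¹; p≢p⁻¹)
open import Algebra.Properties.CommutativeMonoid.Sum +-0-commutativeMonoid using (sum; sum-remove; sum-cong-≗)
open import Data.Product using (proj₁; proj₂)
open import Function using (_∘_)
open import Data.Sum using (_⊎_; inj₁; inj₂)
open import Data.Vec.Functional using (Vector; removeAt)
open import Relation.Nullary using (¬_; Dec; yes; no)
open import Relation.Nullary.Decidable using (_⊎-dec_; _×-dec_; from-yes)
open import Relation.Binary.PropositionalEquality using (refl; sym; trans; cong; cong₂; module ≡-Reasoning)

bit₀ bit₁ : Fin 4 → Parity
bit₀ a = parity (toℕ a)
bit₁ 0F = 0ℙ
bit₁ 1F = 0ℙ
bit₁ 2F = 1ℙ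
bit₁ 3F = 1ℙ

separator : Fin 3 → Fin 4 → Parity
separator 0F = bit₁
separator 1F = bit₀
separator 2F a = bit₀ a + bit₁ a

separator-table : ∀ c a b → a ≡ b ⊎ colour a b ≡ c ⊎ separator c b ≡ separator c a ⁻¹
separator-table = from-yes (all? λ c → all? λ a → all? λ b →
  (a ≟ᶠ b) ⊎-dec (colour a b ≟ᶠ c) ⊎-dec (separator c b ≟ᵖ separator c a ⁻¹))

separator-flips : ∀ c {a b} → a ≢ b → colour a b ≢ c → separator c b ≡ separator c a ⁻¹
separator-flips c {a} {b} a≢b ab≢c with separator-table c a b
... | inj₁ a≡b = ⊥-elim (a≢b a≡b)
... | inj₂ (inj₁ ab≡c) = ⊥-elim (ab≢c ab≡c)
... | inj₂ (inj₂ flips) = flips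

sum-flip : ∀ {n} (g h : Vector Parity n) d →
           h d ≡ g d ⁻¹ → (∀ j → j ≢ d → g j ≡ h j) → sum h ≡ sum g ⁻¹
-- p ⁻¹ and 1ℙ + p are definitionally equal, so associativity moves the flip outwards.
sum-flip {suc n} g h d hd≡gd⁻¹ agree = begin
  sum h                         ≡⟨ sum-remove h ⟩
  h d + sum (removeAt h d)      ≡⟨ cong₂ _+_ hd≡gd⁻¹ (sum-cong-≗ rest-agrees) ⟩
  g d ⁻¹ + sum (removeAt g d)   ≡⟨ +-assoc 1ℙ (g d) _ ⟩
  (g d + sum (removeAt g d)) ⁻¹ ≡⟨ cong _⁻¹ (sym (sum-remove g)) ⟩
  sum g ⁻¹                      ∎
  where
  open ≡-Reasoning
  rest-agrees : ∀ j → removeAt h d j ≡ removeAt g d j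
  rest-agrees j = sym (agree (punchIn d j) (punchInᵢ≢i d j))

label : ∀ {n} → (Fin n → Fin 3) → Word n → Parity
label χ w = sum λ j → separator (χ j) (w j)

label-flips : ∀ {n} (χ : Fin n → Fin 3) {u v : Word n} {d} →
              AdjacentIn u v d → colour (u d) (v d) ≢ χ d → label χ v ≡ label χ u ⁻¹
label-flips χ {d = d} (ud≢vd , agree) uv≢χd =
  sum-flip _ _ d (separator-flips (χ d) ud≢vd uv≢χd) λ j j≢d → cong (separator (χ j)) (agree j j≢d)

parity-suc-+ : ∀ k p → parity (suc k) + p ≡ (parity k + p) ⁻¹
parity-suc-+ k p = trans (cong (_+ p) (sym (⁻¹-selfInverse (suc-homo-⁻¹ k)))) (+-assoc 1ℙ (parity k) p)

%2≡1⇒parity≡1ℙ : ∀ k → k % 2 ≡ 1 → parity k ≡ 1ℙ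
%2≡1⇒parity≡1ℙ 1 _ = refl
%2≡1⇒parity≡1ℙ (suc (suc k)) k%2≡1 = %2≡1⇒parity≡1ℙ k k%2≡1

next-fromℕ< : ∀ {m k} .(k< : k < suc m) (sk< : suc k < suc m) → next (fromℕ< k<) ≡ fromℕ< sk<
next-fromℕ< {m} {k} k< sk< = toℕ-injective (begin
  toℕ (next (fromℕ< k<))       ≡⟨ toℕ-fromℕ< _ ⟩
  suc (toℕ (fromℕ< k<)) % suc m ≡⟨ cong (λ x → suc x % suc m) (toℕ-fromℕ< k<) ⟩
  suc k % suc m                 ≡⟨ m<n⇒m%n≡m sk< ⟩
  suc k                         ≡⟨ toℕ-fromℕ< sk< ⟨
  toℕ (fromℕ< sk<)              ∎)
  where open ≡-Reasoning

next-last : ∀ m → next (fromℕ< (n<1+n m)) ≡ zero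
next-last m = toℕ-injective (begin
  toℕ (next (fromℕ< (n<1+n m)))          ≡⟨ toℕ-fromℕ< _ ⟩
  suc (toℕ (fromℕ< (n<1+n m))) % suc m   ≡⟨ cong (λ x → suc x % suc m) (toℕ-fromℕ< (n<1+n m)) ⟩
  suc m % suc m                          ≡⟨ n%n≡0 (suc m) ⟩
  0                                      ∎)
  where open ≡-Reasoning

alternating⇒even-length : ∀ {m} (h : Fin (suc m) → Parity) →
                          (∀ i → h (next i) ≡ h i ⁻¹) → parity (suc m) ≡ 0ℙ
alternating⇒even-length {m} h alternates = sym (+-cancelʳ-≡ (h zero) 0ℙ (parity (suc m)) (begin
  h zero                            ≡⟨ cong h (next-last m) ⟨
  h (next (fromℕ< (n<1+n m)))       ≡⟨ alternates _ ⟩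
  h (fromℕ< (n<1+n m)) ⁻¹           ≡⟨ cong _⁻¹ (walk m (n<1+n m)) ⟩
  (parity m + h zero) ⁻¹            ≡⟨ parity-suc-+ m (h zero) ⟨
  parity (suc m) + h zero           ∎))
  where
  open ≡-Reasoning
  walk : ∀ k (k< : k < suc m) → h (fromℕ< k<) ≡ parity k + h zero
  walk 0 _ = refl
  walk (suc k) sk< = begin
    h (fromℕ< sk<)                  ≡⟨ cong h (next-fromℕ< k< sk<) ⟨
    h (next (fromℕ< k<))            ≡⟨ alternates _ ⟩
    h (fromℕ< k<) ⁻¹                ≡⟨ cong _⁻¹ (walk k k<) ⟩
    (parity k + h zero) ⁻¹          ≡⟨ parity-suc-+ k (h zero) ⟨
    parity (suc k) + h zero         ∎
    where
    k< : k < suc m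
    k< = <-trans (n<1+n k) sk<

module _ {n m : ℕ} (C : Cycle n m) where
  open Cycle C

  direction : Fin (suc m) → Fin n
  direction i = proj₁ (adjacent i)

  EdgeOfColour : Fin n → Fin 3 → Set
  EdgeOfColour d c = Σ (Fin (suc m)) λ i → direction i ≡ d × edgeColour C i d ≡ c

  edgeOfColour? : ∀ d c → Dec (EdgeOfColour d c)
  edgeOfColour? d c = any? λ i → (direction i ≟ᶠ d) ×-dec (edgeColour C i d ≟ᶠ c)

  Rainbow : Fin n → Set
  Rainbow d = ∀ c → EdgeOfColour d c

  missing-colours⇒even-length : (χ : Fin n → Fin 3) → (∀ d → ¬ EdgeOfColour d (χ d)) →
                                parity (suc m) ≡ 0ℙ
  missing-colours⇒even-length χ missing = alternating⇒even-length (label χ ∘ vert) λ i →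
    label-flips χ (proj₂ (adjacent i)) λ coloured → missing (direction i) (i , refl , coloured)

  odd-length⇒rainbow : parity (suc m) ≡ 1ℙ → ∃ Rainbow
  odd-length⇒rainbow odd with any? (λ d → all? (edgeOfColour? d))
  ... | yes rainbow = rainbow
  ... | no ¬rainbow = ⊥-elim (p≢p⁻¹ 0ℙ (trans (sym (missing-colours⇒even-length χ missing)) odd))
    where
    missingAt : ∀ d → ∃ λ c → ¬ EdgeOfColour d c
    missingAt d = ¬∀⟶∃¬ 3 (EdgeOfColour d) (edgeOfColour? d) λ all → ¬rainbow (d , all)
    χ : Fin n → Fin 3
    χ d = proj₁ (missingAt d)
    missing : ∀ d → ¬ EdgeOfColour d (χ d)
    missing d = proj₂ (missingAt d)

  edgeDir : ∀ {i d} → direction i ≡ d → EdgeDir C i d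
  edgeDir {i} refl = proj₂ (adjacent i)

  colours-differ : ∀ {i j d c c′} → edgeColour C i d ≡ c → edgeColour C j d ≡ c′ → c ≢ c′ →
                   edgeColour C i d ≢ edgeColour C j d
  colours-differ ci cj c≢c′ e = c≢c′ (trans (sym ci) (trans e cj))

  edges-differ : ∀ {i j d} → edgeColour C i d ≢ edgeColour C j d → i ≢ j
  edges-differ {d = d} colours≢ i≡j = colours≢ (cong (λ x → edgeColour C x d) i≡j)

lemma1 : (n : ℕ) → n ≥ 1 → (m : ℕ) → suc m % 2 ≡ 1 → (C : Cycle n m) →
    Σ (Fin n) λ d → Σ (Fin (suc m)) λ i → Σ (Fin (suc m)) λ j → Σ (Fin (suc m)) λ k →
      (i ≢ j) × (j ≢ k) × (i ≢ k) ×
      EdgeDir C i d × EdgeDir C j d × EdgeDir C k d ×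
      (edgeColour C i d ≢ edgeColour C j d) × (edgeColour C j d ≢ edgeColour C k d) ×
      (edgeColour C i d ≢ edgeColour C k d)
lemma1 n _ m odd C with odd-length⇒rainbow C (%2≡1⇒parity≡1ℙ (suc m) odd)
... | d , rainbow with rainbow 0F | rainbow 1F | rainbow 2F
... | i , di , ci | j , dj , cj | k , dk , ck =
  d , i , j , k ,
  edges-differ C ij , edges-differ C jk , edges-differ C ik ,
  edgeDir C di , edgeDir C dj , edgeDir C dk ,
  ij , jk , ik
  where
  ij : edgeColour C i d ≢ edgeColour C j d
  ij = colours-differ C ci cj λ ()
  jk : edgeColour C j d ≢ edgeColour C k d
  jk = colours-differ C cj ck λ ()
  ik : edgeColour C i d ≢ edgeColour C k d
  ik = colours-differ C ci ck λ ()
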